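{- For every integer $k\ge 3$, every asymmetric $k$-graph with at least two vertices has at least $k+2$ vertices; that is, $n(k)\ge k+2$.
   Context: A $k$-graph is a pair $(X,\mathscr{M})$ with $X$ a finite set and $\mathscr{M}\subseteq\binom{X}{k}$. An automorphism is a bijection $\phi:X\to X$ with $\{\phi(M):M\in\mathscr{M}\}=\mathscr{M}$. A $k$-graph is asymmetric if its only automorphism is the identity. $n(k)$ denotes the minimum number of vertices of an asymmetric $k$-graph with at least two vertices. -}

module Defs where

open import Data.Nat using (ℕ)
open import Data.Bool using (Bool; true)
open import Data.Fin using (Fin)
open import Data.Fin.Subset using (Subset; ∣_∣)
open import Data.Fin.Permutation using (Permutation′; _⟨$⟩ʳ_; _⟨$⟩ˡ_)
open import Data.Vec using (tabulate; lookup)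
open import Data.Product using (_×_)
open import Relation.Binary.PropositionalEquality using (_≡_)
open import Function.Bundles using (_⇔_)

-- A k-graph on the vertex set Fin n: the edge family 𝓜 ⊆ binom(Fin n, k) is
-- given by a Boolean predicate on subsets; S is an edge iff 𝓜 S ≡ true and ∣ S ∣ ≡ k.
record KGraph (k n : ℕ) : Set where
  constructor kgraph
  field
    edges : Subset n → Bool

IsEdge : ∀ {k n} → KGraph k n → Subset n → Set
IsEdge {k} 𝓜 S = (KGraph.edges 𝓜 S ≡ true) × (∣ S ∣ ≡ k)

image : ∀ {n} → Permutation′ n → Subset n → Subset n
image φ S = tabulate (λ j → lookup S (φ ⟨$⟩ˡ j))

IsAutomorphism : ∀ {k n} → KGraph k n → Permutation′ n → Set
IsAutomorphism 𝓜 φ = ∀ S → IsEdge 𝓜 S ⇔ IsEdge 𝓜 (image φ S)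

Asymmetric : ∀ {k n} → KGraph k n → Set
Asymmetric {n = n} 𝓜 = ∀ (φ : Permutation′ n) → IsAutomorphism 𝓜 φ → ∀ (i : Fin n) → φ ⟨$⟩ʳ i ≡ i

-- Swapping two vertices i, j is an automorphism unless some edge separates
-- them. If n ≤ k, the only possible edge is the whole vertex set, so any
-- swap works. If n = k + 1, the edges are complements of singletons ∁⁅a⁆,
-- so the graph is a colouring of the vertices by whether ∁⁅a⁆ is an edge;
-- among three vertices two have the same colour, and swapping them is an
-- automorphism.
module Submission where

open import Defs
open import Data.Nat using (ℕ; suc; _≤_; _+_; _∸_; s≤s) renaming (_≟_ to _≟ℕ_)
open import Data.Nat.Properties as ℕ using (_≤?_; ≰⇒>; ≤∧≢⇒<; ≤-antisym)
open import Data.Bool using (Bool; true; false; not)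
open import Data.Fin using (Fin; _≟_)
open import Data.Fin.Patterns using (0F; 1F; 2F)
open import Data.Fin.Subset using (Subset; ∣_∣; ∁; ⁅_⁆; ⊤; _∈_; _∉_; _⊆_)
open import Data.Fin.Subset.Properties
  using (_∈?_; ∣p∣≤n; ∣p∣≡n⇒p≡⊤; p⊂q⇒∣p∣<∣q∣; ⊆-antisym; x∈⁅y⁆⇔x≡y; x≢y⇒x∉⁅y⁆;
         x∉p⇒x∈∁p; ∣⁅x⁆∣≡1; ∣∁p∣≡n∸∣p∣)
open import Data.Fin.Permutation using (Permutation′; _⟨$⟩ʳ_; _⟨$⟩ˡ_; transpose; inverseˡ; inverseʳ)
import Data.Fin.Permutation.Components as PC
open import Data.Vec using (lookup; tabulate)
open import Data.Vec.Properties
  using (tabulate∘lookup; lookup∘tabulate; tabulate-cong; lookup-map; lookup-replicate; []=⇒lookup; lookup⇒[]=)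
open import Data.Product using (_,_)
open import Data.Sum using (_⊎_; inj₁; inj₂; [_,_])
open import Data.Empty using (⊥)
open import Function using (_∘_)
open import Function.Bundles using (Equivalence; mk⇔)
open import Relation.Nullary using (¬_; yes; no; contradiction)
open import Relation.Nullary.Decidable using (dec-true; dec-false)
open import Relation.Binary.PropositionalEquality
  using (_≡_; _≢_; refl; sym; trans; cong; subst; module ≡-Reasoning)

private
  variable
    k n : ℕ

lookup-ext : {p q : Subset n} → (∀ x → lookup p x ≡ lookup q x) → p ≡ q
lookup-ext {p = p} {q} eq = begin
  p                      ≡⟨ tabulate∘lookup p ⟨
  tabulate (lookup p)    ≡⟨ tabulate-cong eq ⟩
  tabulate (lookup q)    ≡⟨ tabulate∘lookup q ⟩
  q                      ∎
  where open ≡-Reasoning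

lookup≡false⇒∉ : {p : Subset n} {x : Fin n} → lookup p x ≡ false → x ∉ p
lookup≡false⇒∉ px≡false x∈p with () ← trans (sym ([]=⇒lookup x∈p)) px≡false

lookup-cong-∈ : {p q : Subset n} {x y : Fin n} →
                (x ∈ p → y ∈ q) → (y ∈ q → x ∈ p) → lookup p x ≡ lookup q y
lookup-cong-∈ {p = p} {q} {x} {y} to from with lookup p x in px | lookup q y in qy
... | true  | true  = refl
... | false | false = refl
... | true  | false = contradiction (to (lookup⇒[]= x p px)) (lookup≡false⇒∉ qy)
... | false | true  = contradiction (from (lookup⇒[]= y q qy)) (lookup≡false⇒∉ px)

p⊆q∧∣q∣≤∣p∣⇒p≡q : {p q : Subset n} → p ⊆ q → ∣ q ∣ ≤ ∣ p ∣ → p ≡ q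
p⊆q∧∣q∣≤∣p∣⇒p≡q {p = p} {q} p⊆q ∣q∣≤∣p∣ = ⊆-antisym p⊆q q⊆p
  where
  q⊆p : q ⊆ p
  q⊆p {x} x∈q with x ∈? p
  ... | yes x∈p = x∈p
  ... | no  x∉p = contradiction (ℕ.<-≤-trans (p⊂q⇒∣p∣<∣q∣ (p⊆q , x , x∈q , x∉p)) ∣q∣≤∣p∣) (ℕ.<-irrefl refl)

∣∁⁅x⁆∣≡n∸1 : (x : Fin n) → ∣ ∁ ⁅ x ⁆ ∣ ≡ n ∸ 1
∣∁⁅x⁆∣≡n∸1 {n} x = trans (∣∁p∣≡n∸∣p∣ ⁅ x ⁆) (cong (n ∸_) (∣⁅x⁆∣≡1 x))

x∉p∧∣p∣≡n∸1⇒p≡∁⁅x⁆ : {p : Subset n} {x : Fin n} → x ∉ p → ∣ p ∣ ≡ n ∸ 1 → p ≡ ∁ ⁅ x ⁆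
x∉p∧∣p∣≡n∸1⇒p≡∁⁅x⁆ {p = p} {x} x∉p ∣p∣≡n∸1 =
  p⊆q∧∣q∣≤∣p∣⇒p≡q p⊆∁⁅x⁆ (ℕ.≤-reflexive (trans (∣∁⁅x⁆∣≡n∸1 x) (sym ∣p∣≡n∸1)))
  where
  p⊆∁⁅x⁆ : p ⊆ ∁ ⁅ x ⁆
  p⊆∁⁅x⁆ {y} y∈p = x∉p⇒x∈∁p (x≢y⇒x∉⁅y⁆ λ { refl → x∉p y∈p })

lookup-image : (φ : Permutation′ n) (p : Subset n) (x : Fin n) →
               lookup (image φ p) x ≡ lookup p (φ ⟨$⟩ˡ x)
lookup-image φ p x = lookup∘tabulate _ x

image-∁ : (φ : Permutation′ n) (p : Subset n) → image φ (∁ p) ≡ ∁ (image φ p)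
image-∁ φ p = lookup-ext λ x → begin
  lookup (image φ (∁ p)) x          ≡⟨ lookup-image φ (∁ p) x ⟩
  lookup (∁ p) (φ ⟨$⟩ˡ x)           ≡⟨ lookup-map (φ ⟨$⟩ˡ x) _ p ⟩
  not (lookup p (φ ⟨$⟩ˡ x))         ≡⟨ cong not (lookup-image φ p x) ⟨
  not (lookup (image φ p) x)        ≡⟨ lookup-map x _ (image φ p) ⟨
  lookup (∁ (image φ p)) x          ∎
  where open ≡-Reasoning

image-⁅⁆ : (φ : Permutation′ n) (a : Fin n) → image φ ⁅ a ⁆ ≡ ⁅ φ ⟨$⟩ʳ a ⁆
image-⁅⁆ φ a = lookup-ext λ x → trans (lookup-image φ ⁅ a ⁆ x) (lookup-cong-∈
  (λ φ⁻¹x∈⁅a⁆ → from x∈⁅y⁆⇔x≡y (trans (sym (inverseʳ φ)) (cong (φ ⟨$⟩ʳ_) (to x∈⁅y⁆⇔x≡y φ⁻¹x∈⁅a⁆))))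
  (λ x∈⁅φa⁆ → from x∈⁅y⁆⇔x≡y (trans (cong (φ ⟨$⟩ˡ_) (to x∈⁅y⁆⇔x≡y x∈⁅φa⁆)) (inverseˡ φ))))
  where open Equivalence

image-∁⁅⁆ : (φ : Permutation′ n) (a : Fin n) → image φ (∁ ⁅ a ⁆) ≡ ∁ ⁅ φ ⟨$⟩ʳ a ⁆
image-∁⁅⁆ φ a = trans (image-∁ φ ⁅ a ⁆) (cong ∁ (image-⁅⁆ φ a))

transpose-comm : (i j x : Fin n) → PC.transpose i j x ≡ PC.transpose j i x
transpose-comm i j x with x ≟ i | x ≟ j
... | yes x≡i | yes x≡j = trans (sym x≡j) x≡i
... | yes x≡i | no  _   rewrite dec-true (x ≟ i) x≡i = refl
... | no  _   | yes x≡j rewrite dec-true (x ≟ j) x≡j = refl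
... | no  x≢i | no  x≢j rewrite dec-false (x ≟ i) x≢i | dec-false (x ≟ j) x≢j = refl

transpose-involutive : (i j x : Fin n) → PC.transpose i j (PC.transpose i j x) ≡ x
transpose-involutive i j x =
  trans (transpose-comm i j (PC.transpose i j x)) (PC.transpose-inverse j i)

transpose-matchˡ : (i j : Fin n) → PC.transpose i j i ≡ j
transpose-matchˡ i j with i ≟ i
... | yes _   = refl
... | no  i≢i = contradiction refl i≢i

transpose-matchʳ : (i j : Fin n) → PC.transpose i j j ≡ i
transpose-matchʳ i j = trans (transpose-comm i j j) (transpose-matchˡ j i)

image-transpose-involutive : (i j : Fin n) (p : Subset n) →
                             image (transpose i j) (image (transpose i j) p) ≡ p
image-transpose-involutive i j p = lookup-ext λ x → begin
  lookup (image τ (image τ p)) x          ≡⟨ lookup-image τ (image τ p) x ⟩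
  lookup (image τ p) (τ ⟨$⟩ˡ x)           ≡⟨ lookup-image τ p (τ ⟨$⟩ˡ x) ⟩
  lookup p (τ ⟨$⟩ˡ (τ ⟨$⟩ˡ x))            ≡⟨ cong (lookup p) (transpose-involutive j i x) ⟩
  lookup p x                              ∎
  where open ≡-Reasoning
        τ = transpose i j

image-transpose-fixes : (i j : Fin n) (p : Subset n) → lookup p i ≡ lookup p j →
                        image (transpose i j) p ≡ p
image-transpose-fixes i j p pi≡pj = lookup-ext λ x → trans (lookup-image (transpose i j) p x) (fixes x)
  where
  fixes : ∀ x → lookup p (PC.transpose j i x) ≡ lookup p x
  fixes x with x ≟ j
  ... | yes refl = pi≡pj
  ... | no _ with x ≟ i
  ...   | yes refl = sym pi≡pj
  ...   | no _     = refl

module _ (𝓜 : KGraph k n) where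

  transpose-automorphism : (i j : Fin n) →
                           (∀ p → IsEdge 𝓜 p → IsEdge 𝓜 (image (transpose i j) p)) →
                           IsAutomorphism 𝓜 (transpose i j)
  transpose-automorphism i j preserves p = mk⇔ (preserves p)
    (subst (IsEdge 𝓜) (image-transpose-involutive i j p) ∘ preserves (image (transpose i j) p))

  asymmetric⇒¬transpose-automorphism : Asymmetric 𝓜 → {i j : Fin n} → i ≢ j →
                                        ¬ IsAutomorphism 𝓜 (transpose i j)
  asymmetric⇒¬transpose-automorphism asym {i} {j} i≢j aut =
    i≢j (trans (sym (asym (transpose i j) aut i)) (transpose-matchˡ i j))

  edge⇒≡⊤ : n ≤ k → {p : Subset n} → IsEdge 𝓜 p → p ≡ ⊤
  edge⇒≡⊤ n≤k {p} (_ , ∣p∣≡k) = ∣p∣≡n⇒p≡⊤ (≤-antisym (∣p∣≤n p) (subst (n ≤_) (sym ∣p∣≡k) n≤k))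

  transpose-automorphism-≤ : n ≤ k → (i j : Fin n) → IsAutomorphism 𝓜 (transpose i j)
  transpose-automorphism-≤ n≤k i j = transpose-automorphism i j λ p p∈𝓜 →
    let pi≡pj = subst (λ q → lookup q i ≡ lookup q j) (sym (edge⇒≡⊤ n≤k p∈𝓜))
                  (trans (lookup-replicate i true) (sym (lookup-replicate j true)))
    in subst (IsEdge 𝓜) (sym (image-transpose-fixes i j p pi≡pj)) p∈𝓜

¬asymmetric-≤ : 2 ≤ n → n ≤ k → (𝓜 : KGraph k n) → ¬ Asymmetric 𝓜
¬asymmetric-≤ (s≤s (s≤s _)) n≤k 𝓜 asym =
  asymmetric⇒¬transpose-automorphism 𝓜 asym {0F} {1F} (λ ()) (transpose-automorphism-≤ 𝓜 n≤k 0F 1F)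

module _ (𝓜 : KGraph k (suc k)) where

  open KGraph 𝓜 using (edges)

  image-∁⁅⁆-edge : (φ : Permutation′ (suc k)) (a : Fin (suc k)) →
                   edges (∁ ⁅ a ⁆) ≡ edges (∁ ⁅ φ ⟨$⟩ʳ a ⁆) →
                   IsEdge 𝓜 (∁ ⁅ a ⁆) → IsEdge 𝓜 (image φ (∁ ⁅ a ⁆))
  image-∁⁅⁆-edge φ a same (∁⁅a⁆∈𝓜 , _) =
    subst (IsEdge 𝓜) (sym (image-∁⁅⁆ φ a)) (trans (sym same) ∁⁅a⁆∈𝓜 , ∣∁⁅x⁆∣≡n∸1 (φ ⟨$⟩ʳ a))

  edge⇒≡∁⁅⁆ : {p : Subset (suc k)} {a : Fin (suc k)} → IsEdge 𝓜 p → lookup p a ≡ false → p ≡ ∁ ⁅ a ⁆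
  edge⇒≡∁⁅⁆ (_ , ∣p∣≡k) pa≡false = x∉p∧∣p∣≡n∸1⇒p≡∁⁅x⁆ (lookup≡false⇒∉ pa≡false) ∣p∣≡k

  transpose-automorphism-∁⁅⁆ : (i j : Fin (suc k)) → edges (∁ ⁅ i ⁆) ≡ edges (∁ ⁅ j ⁆) →
                               IsAutomorphism 𝓜 (transpose i j)
  transpose-automorphism-∁⁅⁆ i j same = transpose-automorphism 𝓜 i j preserves
    where
    fixed : ∀ p → lookup p i ≡ lookup p j → IsEdge 𝓜 p → IsEdge 𝓜 (image (transpose i j) p)
    fixed p pi≡pj = subst (IsEdge 𝓜) (sym (image-transpose-fixes i j p pi≡pj))

    preserves : ∀ p → IsEdge 𝓜 p → IsEdge 𝓜 (image (transpose i j) p)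
    preserves p p∈𝓜 with lookup p i in pi | lookup p j in pj
    ... | true  | true  = fixed p (trans pi (sym pj)) p∈𝓜
    ... | false | false = fixed p (trans pi (sym pj)) p∈𝓜
    ... | false | true  with refl ← edge⇒≡∁⁅⁆ p∈𝓜 pi =
      image-∁⁅⁆-edge (transpose i j) i (trans same (cong (edges ∘ ∁ ∘ ⁅_⁆) (sym (transpose-matchˡ i j)))) p∈𝓜
    ... | true  | false with refl ← edge⇒≡∁⁅⁆ p∈𝓜 pj =
      image-∁⁅⁆-edge (transpose i j) j (trans (sym same) (cong (edges ∘ ∁ ∘ ⁅_⁆) (sym (transpose-matchʳ i j)))) p∈𝓜

Bool-pigeonhole : (a b c : Bool) → a ≡ b ⊎ a ≡ c ⊎ b ≡ c
Bool-pigeonhole true  true  _     = inj₁ refl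
Bool-pigeonhole false false _     = inj₁ refl
Bool-pigeonhole true  false true  = inj₂ (inj₁ refl)
Bool-pigeonhole true  false false = inj₂ (inj₂ refl)
Bool-pigeonhole false true  true  = inj₂ (inj₂ refl)
Bool-pigeonhole false true  false = inj₂ (inj₁ refl)

¬asymmetric-suc : 2 ≤ k → (𝓜 : KGraph k (suc k)) → ¬ Asymmetric 𝓜
¬asymmetric-suc (s≤s (s≤s _)) 𝓜 asym =
  [ swap 0F 1F (λ ()) , [ swap 0F 2F (λ ()) , swap 1F 2F (λ ()) ] ]
    (Bool-pigeonhole (colour 0F) (colour 1F) (colour 2F))
  where
  colour : Fin _ → Bool
  colour a = KGraph.edges 𝓜 (∁ ⁅ a ⁆)

  swap : ∀ i j → i ≢ j → colour i ≡ colour j → ⊥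
  swap i j i≢j same = asymmetric⇒¬transpose-automorphism 𝓜 asym i≢j (transpose-automorphism-∁⁅⁆ 𝓜 i j same)

lemma6 : ∀ (k n : ℕ) → 3 ≤ k → 2 ≤ n → (𝓜 : KGraph k n) → Asymmetric 𝓜 → k + 2 ≤ n
lemma6 k n 3≤k 2≤n 𝓜 asym with n ≤? k
... | yes n≤k = contradiction asym (¬asymmetric-≤ 2≤n n≤k 𝓜)
... | no  n≰k with suc k ≟ℕ n
...   | yes refl = contradiction asym (¬asymmetric-suc (ℕ.<⇒≤ 3≤k) 𝓜)
...   | no  k+1≢n = subst (_≤ n) (ℕ.+-comm 2 k) (≤∧≢⇒< (≰⇒> n≰k) k+1≢n)
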